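{- For every positive integer $b$, there exists a positive integer $k$ such that the formula with reversal $$\phi_k = x_0x_1\cdot x_1x_2\cdot \ldots \cdot x_{k-2}x_{k-1}\cdot x_{k-1}x_0\cdot x_0^R\cdot x_1^R\cdot\ldots\cdot x_{k-1}^R$$ (on the $k$ variables $x_0,\dots,x_{k-1}$) satisfies $b<\lambda(\phi_k)\le k+1$.
   Context: A formula with reversal is a finite set of words (called fragments, written separated by dots) over an alphabet of variables, where each variable $x$ may occur either as $x$ or as $x^R$. An occurrence of a formula with reversal $F$ in a word $w$ is a map $h$ assigning to each variable a nonempty word, extended to fragments by concatenation with the convention $h(x^R)=h(x)^R$ (the reverse, i.e. mirror image, of $h(x)$), such that $h(f)$ is a factor of $w$ for every fragment $f$ of $F$. A (finite or infinite) word avoids $F$ if it contains no occurrence of $F$. The avoidability index $\lambda(F)$ is the minimum number of letters of an alphabet over which there exists an infinite word avoiding $F$ ($\lambda(F)=\infty$ if no such finite alphabet exists). -}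

module Defs where

open import Data.Nat using (ℕ; zero; suc; _≤_; _<_; NonZero)
open import Data.Nat.DivMod using (_mod_)
open import Data.Fin using (Fin; toℕ)
open import Data.Bool using (Bool; true; false; if_then_else_)
open import Data.List using (List; []; _∷_; length; map; reverse; concatMap; allFin; _++_)
open import Data.List.Membership.Propositional using (_∈_)
open import Data.Product using (_×_; _,_; ∃-syntax; Σ-syntax)
open import Relation.Binary.PropositionalEquality using (_≡_)
open import Relation.Nullary using (¬_)

-- A variable occurrence: variable x together with a flag; (x , true) stands for x^R.
Letter : ℕ → Set
Letter k = Fin k × Bool

Fragment : ℕ → Set
Fragment k = List (Letter k)

Formula : ℕ → Set
Formula k = List (Fragment k)

NonEmpty : {A : Set} → List A → Set
NonEmpty u = ¬ (u ≡ [])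

image : {A : Set} {k : ℕ} → (Fin k → List A) → Fragment k → List A
image h = concatMap (λ { (x , r) → if r then reverse (h x) else h x })

window : {A : Set} → (ℕ → A) → ℕ → ℕ → List A
window w i zero    = []
window w i (suc n) = w i ∷ window w (suc i) n

Factor : {A : Set} → List A → (ℕ → A) → Set
Factor u w = ∃[ i ] (window w i (length u) ≡ u)

Occurrence : {A : Set} {k : ℕ} → Formula k → (ℕ → A) → (Fin k → List A) → Set
Occurrence F w h = (∀ x → NonEmpty (h x)) × (∀ f → f ∈ F → Factor (image h f) w)

Avoids : {A : Set} {k : ℕ} → (ℕ → A) → Formula k → Set
Avoids w F = ¬ (∃[ h ] Occurrence F w h)

AvoidableOver : {k : ℕ} → Formula k → ℕ → Set
AvoidableOver F n = ∃[ w ] Avoids {Fin n} w F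

-- λ(F) ≤ m : some alphabet of size at most m admits an infinite avoiding word.
IndexAtMost : {k : ℕ} → Formula k → ℕ → Set
IndexAtMost F m = ∃[ n ] (n ≤ m × AvoidableOver F n)

-- b < λ(F) : no alphabet of size at most b admits an infinite avoiding word.
IndexGreaterThan : {k : ℕ} → Formula k → ℕ → Set
IndexGreaterThan F b = ∀ n → n ≤ b → ¬ AvoidableOver F n

-- φ_k with k = suc m variables x_0..x_{k-1}:
-- fragments x_i x_{(i+1) mod k} for i < k, followed by x_i^R for i < k.
phi : (m : ℕ) → Formula (suc m)
phi m = map (λ i → (i , false) ∷ ((suc (toℕ i) mod (suc m)) , false) ∷ []) (allFin (suc m))
     ++ map (λ i → (i , true) ∷ []) (allFin (suc m))

module Submission where

-- Lower bound: in an infinite word over n ≤ b letters two of the first n + 1 letters coincide, so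
-- some factor w p … w (p + d) with 1 ≤ d ≤ b has equal ends. If d divides k, assigning to x_t the
-- single letter w (p + t mod d) is an occurrence of φ_k, since the cyclic successor t ↦ t + 1 mod k
-- is compatible with reduction mod d. Taking k = (b + 1)! handles all d ≤ b at once.
--
-- Upper bound: the word 0 1 … k 0 1 … k … over k + 1 letters avoids φ_k (k ≥ 2). Its factors
-- of length two are the pairs (a , a + 1), and a + 2 ≢ a mod k + 1, so a word of length at least
-- two is never a factor together with its reverse. Hence every h (x_t) is a letter a_t, the
-- fragments x_t x_{t+1} force a_{t+1} = a_t + 1, and going once around the k variables gives
-- a_0 + k ≡ a_0 mod k + 1, which is impossible.

open import Defs
open import Data.Nat using (ℕ; zero; suc; pred; _+_; _*_; _%_; _/_; _≤_; _<_; NonZero; >-nonZero; z≤n; s≤s; _!)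
open import Data.Nat.Properties
open import Data.Nat.DivMod using (_mod_; m≡m%n+[m/n]*n; %-distribˡ-+; m%n%n≡m%n; m%n<n; m<n⇒m%n≡m; n%n≡0; [m+n]%n≡m%n; m∣n⇒o%n%m≡o%m)
open import Data.Nat.Divisibility using (_∣_; divides; >⇒∤; ∣-trans; m∣m*n; m≤n⇒m!∣n!)
open import Data.Nat.GeneralisedArithmetic using (fold)
open import Data.Fin using (Fin; toℕ)
open import Data.Fin.Properties using (toℕ-fromℕ<; fromℕ<-cong; toℕ-injective; toℕ<n; pigeonhole)
open import Data.Bool using (true; false)
open import Data.List using (List; []; _∷_; length; map; reverse; allFin; _++_)
open import Data.List.Properties using (∷-injective; reverse-++)
open import Data.List.Membership.Propositional using (_∈_)
open import Data.List.Membership.Propositional.Properties using (∈-++⁻; ∈-++⁺ˡ; ∈-++⁺ʳ; ∈-map⁻; ∈-map⁺; ∈-allFin)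
open import Data.Product using (_×_; _,_; ∃-syntax; proj₁; proj₂)
open import Data.Sum using (_⊎_; inj₁; inj₂)
open import Data.Empty using (⊥-elim)
open import Function using (_∘_)
open import Relation.Binary.PropositionalEquality using (_≡_; _≢_; refl; sym; trans; cong; subst; subst₂; module ≡-Reasoning)
open import Relation.Nullary using (¬_)

open ≡-Reasoning

suc[m%n]%n≡suc[m]%n : ∀ m n .{{_ : NonZero n}} → suc (m % n) % n ≡ suc m % n
suc[m%n]%n≡suc[m]%n m n = begin
  suc (m % n) % n            ≡⟨ %-distribˡ-+ 1 (m % n) n ⟩
  (1 % n + m % n % n) % n    ≡⟨ cong (λ r → (1 % n + r) % n) (m%n%n≡m%n m n) ⟩
  (1 % n + m % n) % n        ≡⟨ %-distribˡ-+ 1 m n ⟨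
  suc m % n                  ∎

[m+j]%n≢m : ∀ m {j n} .{{_ : NonZero n}} → 0 < j → j < n → (m + j) % n ≢ m
[m+j]%n≢m m {j} {n} 0<j j<n eq =
  >⇒∤ {{>-nonZero 0<j}} j<n (divides ((m + j) / n) (+-cancelˡ-≡ m j _ (begin
  m + j                              ≡⟨ m≡m%n+[m/n]*n (m + j) n ⟩
  (m + j) % n + (m + j) / n * n      ≡⟨ cong (_+ (m + j) / n * n) eq ⟩
  m + (m + j) / n * n                ∎)))

fold-natural : ∀ {A B : Set} (f : A → A) (f′ : B → B) (g : A → B) → (∀ x → g (f x) ≡ f′ (g x)) →
               ∀ x t → g (fold x f t) ≡ fold (g x) f′ t
fold-natural f f′ g g∘f≡f′∘g x zero    = refl
fold-natural f f′ g g∘f≡f′∘g x (suc t) = trans (g∘f≡f′∘g _) (cong f′ (fold-natural f f′ g g∘f≡f′∘g x t))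

-- The fragments of phi are x_i x_(sucMod i), definitionally.
sucMod : ∀ {n} → Fin (suc n) → Fin (suc n)
sucMod {n} i = suc (toℕ i) mod suc n

toℕ-sucMod : ∀ {n} (i : Fin (suc n)) → toℕ (sucMod i) ≡ suc (toℕ i) % suc n
toℕ-sucMod {n} i = toℕ-fromℕ< (m%n<n (suc (toℕ i)) (suc n))

toℕ-fold-sucMod : ∀ {n} (i : Fin (suc n)) t → toℕ (fold i sucMod t) ≡ (toℕ i + t) % suc n
toℕ-fold-sucMod {n} i zero    = sym (trans (cong (_% suc n) (+-identityʳ (toℕ i))) (m<n⇒m%n≡m (toℕ<n i)))
toℕ-fold-sucMod {n} i (suc t) = begin
  toℕ (sucMod (fold i sucMod t))       ≡⟨ toℕ-sucMod (fold i sucMod t) ⟩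
  suc (toℕ (fold i sucMod t)) % suc n  ≡⟨ cong (λ r → suc r % suc n) (toℕ-fold-sucMod i t) ⟩
  suc ((toℕ i + t) % suc n) % suc n    ≡⟨ suc[m%n]%n≡suc[m]%n (toℕ i + t) (suc n) ⟩
  suc (toℕ i + t) % suc n              ≡⟨ cong (_% suc n) (+-suc (toℕ i) t) ⟨
  (toℕ i + suc t) % suc n              ∎

fold-sucMod-period : ∀ {n} (i : Fin (suc n)) → fold i sucMod (suc n) ≡ i
fold-sucMod-period {n} i = toℕ-injective (begin
  toℕ (fold i sucMod (suc n))  ≡⟨ toℕ-fold-sucMod i (suc n) ⟩
  (toℕ i + suc n) % suc n      ≡⟨ [m+n]%n≡m%n (toℕ i) (suc n) ⟩
  toℕ i % suc n                ≡⟨ m<n⇒m%n≡m (toℕ<n i) ⟩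
  toℕ i                        ∎)

fold-sucMod-≢ : ∀ {n j} → 0 < j → j < suc n → (i : Fin (suc n)) → fold i sucMod j ≢ i
fold-sucMod-≢ {j = j} 0<j j<n i eq =
  [m+j]%n≢m (toℕ i) 0<j j<n (trans (sym (toℕ-fold-sucMod i j)) (cong toℕ eq))

no-equivariant-map-to-longer-cycle : ∀ {k n} → suc k < suc n → (a : Fin (suc k) → Fin (suc n)) →
                                     ¬ (∀ x → a (sucMod x) ≡ sucMod (a x))
no-equivariant-map-to-longer-cycle {k} k<n a equivariant =
  fold-sucMod-≢ (s≤s z≤n) k<n (a Fin.zero) (begin
  fold (a Fin.zero) sucMod (suc k)  ≡⟨ fold-natural sucMod sucMod a equivariant Fin.zero (suc k) ⟨
  a (fold Fin.zero sucMod (suc k))  ≡⟨ cong a (fold-sucMod-period Fin.zero) ⟩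
  a Fin.zero                        ∎)

window-++⁻ : ∀ {A : Set} (w : ℕ → A) s (u v : List A) → window w s (length (u ++ v)) ≡ u ++ v →
             window w s (length u) ≡ u × window w (s + length u) (length v) ≡ v
window-++⁻ w s []      v eq rewrite +-identityʳ s = refl , eq
window-++⁻ w s (a ∷ u) v eq with ∷-injective eq
... | refl , eq′ with window-++⁻ w (suc s) u v eq′
... | eqᵤ , eqᵥ rewrite +-suc s (length u) = cong (w s ∷_) eqᵤ , eqᵥ

Factor-++⁻ : ∀ {A : Set} {w : ℕ → A} (u v : List A) → Factor (u ++ v) w → Factor u w × Factor v w
Factor-++⁻ {w = w} u v (s , eq) with window-++⁻ w s u v eq
... | eqᵤ , eqᵥ = (s , eqᵤ) , (s + length u , eqᵥ)

edge : ∀ {m} → Fin (suc m) → Fragment (suc m)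
edge i = (i , false) ∷ (sucMod i , false) ∷ []

reversal : ∀ {m} → Fin (suc m) → Fragment (suc m)
reversal i = (i , true) ∷ []

edge∈phi : ∀ {m} (i : Fin (suc m)) → edge i ∈ phi m
edge∈phi i = ∈-++⁺ˡ (∈-map⁺ edge (∈-allFin i))

reversal∈phi : ∀ {m} (i : Fin (suc m)) → reversal i ∈ phi m
reversal∈phi {m} i = ∈-++⁺ʳ (map edge (allFin (suc m))) (∈-map⁺ reversal (∈-allFin i))

∈-phi⁻ : ∀ {m f} → f ∈ phi m → (∃[ i ] f ≡ edge i) ⊎ (∃[ i ] f ≡ reversal i)
∈-phi⁻ {m} f∈ with ∈-++⁻ (map edge (allFin (suc m))) f∈
... | inj₁ f∈edges    with ∈-map⁻ edge f∈edges
...   | i , _ , f≡    = inj₁ (i , f≡)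
∈-phi⁻ f∈ | inj₂ f∈reversals with ∈-map⁻ reversal f∈reversals
...   | i , _ , f≡    = inj₂ (i , f≡)

short-period : ∀ {n} (w : ℕ → Fin n) → ∃[ p ] ∃[ e ] (suc e ≤ n × w (p + suc e) ≡ w p)
short-period {n} w with pigeonhole (n<1+n n) (w ∘ toℕ)
... | i , j , i<j , wi≡wj with m≤n⇒∃[o]m+o≡n i<j
...   | e , i+1+e≡j = toℕ i , e , 1+e≤n , trans (cong w i+[1+e]≡j) (sym wi≡wj)
  where
  i+[1+e]≡j : toℕ i + suc e ≡ toℕ j
  i+[1+e]≡j = trans (+-suc (toℕ i) e) i+1+e≡j

  1+e≤n : suc e ≤ n
  1+e≤n = ≤-trans (m≤n+m (suc e) (toℕ i)) (subst (_≤ n) (sym i+[1+e]≡j) (≤-pred (toℕ<n j)))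

periodic-occurrence : ∀ {A : Set} {w : ℕ → A} {p d} m .{{_ : NonZero d}} → d ∣ suc m →
                      w (p + d) ≡ w p → ∃[ h ] Occurrence (phi m) w h
periodic-occurrence {A} {w} {p} {d} m d∣k period = h , (λ _ ()) , factor
  where
  v : ℕ → A
  v t = w (p + t % d)

  h : Fin (suc m) → List A
  h i = v (toℕ i) ∷ []

  w-reduce : ∀ {s} → s ≤ d → w (p + s) ≡ v s
  w-reduce s≤d with m≤n⇒m<n∨m≡n s≤d
  ... | inj₁ s<d  = cong (λ r → w (p + r)) (sym (m<n⇒m%n≡m s<d))
  ... | inj₂ refl = trans period (cong w (trans (sym (+-identityʳ p)) (cong (p +_) (sym (n%n≡0 d)))))

  v-suc : ∀ t → w (suc (p + t % d)) ≡ v (suc t)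
  v-suc t = begin
    w (suc (p + t % d))  ≡⟨ cong w (+-suc p (t % d)) ⟨
    w (p + suc (t % d))  ≡⟨ w-reduce (m%n<n t d) ⟩
    v (suc (t % d))      ≡⟨ cong (λ r → w (p + r)) (suc[m%n]%n≡suc[m]%n t d) ⟩
    v (suc t)            ∎

  v-sucMod : ∀ i → v (toℕ (sucMod i)) ≡ v (suc (toℕ i))
  v-sucMod i = cong (λ r → w (p + r))
    (trans (cong (_% d) (toℕ-sucMod i)) (m∣n⇒o%n%m≡o%m d (suc m) (suc (toℕ i)) d∣k))

  factor : ∀ f → f ∈ phi m → Factor (image h f) w
  factor f f∈ with ∈-phi⁻ f∈
  ... | inj₁ (i , refl) = p + toℕ i % d
                        , cong (λ a → v (toℕ i) ∷ a ∷ []) (trans (v-suc (toℕ i)) (sym (v-sucMod i)))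
  ... | inj₂ (i , refl) = p + toℕ i % d , refl

phi-index-above : ∀ b m → (∀ d → 1 ≤ d → d ≤ b → d ∣ suc m) → IndexGreaterThan (phi m) b
phi-index-above b m small∣k n n≤b (w , avoids) with short-period w
... | p , e , 1+e≤n , period = avoids (periodic-occurrence m (small∣k (suc e) (s≤s z≤n) (≤-trans 1+e≤n n≤b)) period)

cyclic : ∀ n → ℕ → Fin (suc n)
cyclic n t = t mod suc n

cyclic-suc : ∀ n t → cyclic n (suc t) ≡ sucMod (cyclic n t)
cyclic-suc n t = fromℕ<-cong _ _ (begin
  suc t % suc n                     ≡⟨ suc[m%n]%n≡suc[m]%n t (suc n) ⟨
  suc (t % suc n) % suc n           ≡⟨ cong (λ r → suc r % suc n) (toℕ-fromℕ< (m%n<n t (suc n))) ⟨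
  suc (toℕ (cyclic n t)) % suc n    ∎) _ _

cyclic-factor-sucMod : ∀ {n} {a b : Fin (suc n)} → Factor (a ∷ b ∷ []) (cyclic n) → b ≡ sucMod a
cyclic-factor-sucMod {n} (s , eq) with ∷-injective eq
... | refl , eq′ with ∷-injective eq′
...   | refl , _ = cyclic-suc n s

cyclic-¬reversible-factor : ∀ {n} → 2 < suc n → (a b : Fin (suc n)) (t : List (Fin (suc n))) →
                            Factor (a ∷ b ∷ t) (cyclic n) → ¬ Factor (reverse (a ∷ b ∷ t)) (cyclic n)
cyclic-¬reversible-factor 2<n a b t ab-factor ba-factor = fold-sucMod-≢ (s≤s z≤n) 2<n a (begin
  sucMod (sucMod a)  ≡⟨ cong sucMod b≡sucMod-a ⟨
  sucMod b           ≡⟨ a≡sucMod-b ⟨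
  a                  ∎)
  where
  b≡sucMod-a : b ≡ sucMod a
  b≡sucMod-a = cyclic-factor-sucMod (proj₁ (Factor-++⁻ (a ∷ b ∷ []) t ab-factor))
  a≡sucMod-b : a ≡ sucMod b
  a≡sucMod-b = cyclic-factor-sucMod (proj₂ (Factor-++⁻ (reverse t) (b ∷ a ∷ [])
                 (subst (λ u → Factor u _) (reverse-++ (a ∷ b ∷ []) t) ba-factor)))

cyclic-avoids-phi : ∀ m → 1 ≤ m → Avoids (cyclic (suc m)) (phi m)
cyclic-avoids-phi m 1≤m (h , nonempty , factor) =
  no-equivariant-map-to-longer-cycle (n<1+n (suc m)) letter letter-sucMod
  where
  edge-factor : ∀ x → Factor (h x ++ (h (sucMod x) ++ [])) (cyclic (suc m))
  edge-factor x = factor (edge x) (edge∈phi x)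

  reversal-factor : ∀ x → Factor (reverse (h x)) (cyclic (suc m))
  reversal-factor x = proj₁ (Factor-++⁻ (reverse (h x)) [] (factor (reversal x) (reversal∈phi x)))

  singleton : ∀ x → ∃[ a ] h x ≡ a ∷ []
  singleton x with h x | nonempty x | proj₁ (Factor-++⁻ (h x) _ (edge-factor x)) | reversal-factor x
  ... | []        | ne | _  | _  = ⊥-elim (ne refl)
  ... | a ∷ []    | _  | _  | _  = a , refl
  ... | a ∷ b ∷ t | _  | fu | fr = ⊥-elim (cyclic-¬reversible-factor (s≤s (s≤s 1≤m)) a b t fu fr)

  letter : Fin (suc m) → Fin (suc (suc m))
  letter x = proj₁ (singleton x)

  letter-sucMod : ∀ x → letter (sucMod x) ≡ sucMod (letter x)
  letter-sucMod x = cyclic-factor-sucMod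
    (subst₂ (λ u u′ → Factor (u ++ (u′ ++ [])) (cyclic (suc m)))
            (proj₂ (singleton x)) (proj₂ (singleton (sucMod x))) (edge-factor x))

phi-index-at-most : ∀ m → 1 ≤ m → IndexAtMost (phi m) (suc (suc m))
phi-index-at-most m 1≤m = suc (suc m) , ≤-refl , cyclic (suc m) , cyclic-avoids-phi m 1≤m

∣n! : ∀ {d n} → 1 ≤ d → d ≤ n → d ∣ n !
∣n! {suc d} _ d≤n = ∣-trans (m∣m*n (d !)) (m≤n⇒m!∣n! d≤n)

theorem1 : ∀ (b : ℕ) → 1 ≤ b → ∃[ m ] (IndexGreaterThan (phi m) b × IndexAtMost (phi m) (suc (suc m)))
theorem1 b 1≤b = m , phi-index-above b m small∣k , phi-index-at-most m 1≤m
  where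
  m : ℕ
  m = pred (suc b !)

  k≡[1+b]! : suc m ≡ suc b !
  k≡[1+b]! = suc-pred (suc b !) {{suc b !≢0}}

  small∣k : ∀ d → 1 ≤ d → d ≤ b → d ∣ suc m
  small∣k d 1≤d d≤b = subst (d ∣_) (sym k≡[1+b]!) (∣n! 1≤d (≤-trans d≤b (n≤1+n b)))

  1≤m : 1 ≤ m
  1≤m = pred-mono-≤ (*-mono-≤ (s≤s 1≤b) (1≤n! b))
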